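{- Let $\mathcal{F}\subseteq\binom{[6]}{3}$ be the family of all $3$-element subsets $F$ of $[6]$ such that $\sum_{i\in F} i\equiv h \pmod 6$ for some $h\in\{1,3,4\}$. Then every $A\in\binom{[6]}{3}$ is almost shattered by $\mathcal{F}$.
   Context: For a family $\mathcal{F}$ and set $X$, $\mathcal{F}|_X=\{F\cap X:F\in\mathcal{F}\}$; $\mathcal{F}$ almost shatters $X$ if $\mathcal{F}|_X=2^X\setminus\{\emptyset\}$ or $\mathcal{F}|_X=2^X\setminus\{X\}$. -}

module Defs where

open import Data.Nat using (ℕ; suc; _+_; _%_)
open import Data.Fin using (Fin; toℕ)
open import Data.Fin.Subset using (Subset; _∈_; _⊆_; _∩_; ∣_∣; ⊥)
open import Data.List using (List; _∷_; []; map; filter; allFin)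
open import Data.Nat.ListAction using (sum)
open import Data.List.Membership.Propositional using () renaming (_∈_ to _∈ₗ_)
open import Data.Fin.Subset.Properties using (_∈?_)
open import Data.Product using (Σ; _×_; ∃-syntax)
open import Relation.Binary.PropositionalEquality using (_≡_; _≢_)
open import Level using (0ℓ; suc)
open import Relation.Unary using (Pred)

-- Ground set [6] = {1,...,6}; element i : Fin 6 represents the number (toℕ i + 1).
-- A family of subsets of [n] is a predicate on Subset n.
Family : ℕ → Set₁
Family n = Pred (Subset n) 0ℓ

elemSum : {n : ℕ} → Subset n → ℕ
elemSum {n} F = sum (map (λ i → Data.Nat.suc (toℕ i)) (filter (_∈? F) (allFin n)))

𝓕 : Family 6
𝓕 F = (∣ F ∣ ≡ 3) × (elemSum F % 6 ∈ₗ (1 ∷ 3 ∷ 4 ∷ []))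

Trace : {n : ℕ} → Family n → Subset n → Family n
Trace 𝓖 X S = ∃[ G ] (𝓖 G × G ∩ X ≡ S)

TraceIsPowMinusEmpty : {n : ℕ} → Family n → Subset n → Set
TraceIsPowMinusEmpty 𝓖 X = ∀ S → (Trace 𝓖 X S → S ⊆ X × S ≢ ⊥) × (S ⊆ X × S ≢ ⊥ → Trace 𝓖 X S)

TraceIsPowMinusFull : {n : ℕ} → Family n → Subset n → Set
TraceIsPowMinusFull 𝓖 X = ∀ S → (Trace 𝓖 X S → S ⊆ X × S ≢ X) × (S ⊆ X × S ≢ X → Trace 𝓖 X S)

open import Data.Sum using (_⊎_)

AlmostShatters : {n : ℕ} → Family n → Subset n → Set
AlmostShatters 𝓖 X = TraceIsPowMinusEmpty 𝓖 X ⊎ TraceIsPowMinusFull 𝓖 X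

-- The statement is a finite property over the 64 subsets of [6]; it is decided by evaluation.

module Submission where

open import Defs
open import Data.Nat using (_%_)
import Data.Nat as ℕ
open import Data.Bool using () renaming (_≟_ to _≟ᵇ_)
open import Data.Vec.Properties using (≡-dec)
open import Data.List using (_∷_; [])
open import Data.List.Membership.DecPropositional ℕ._≟_ using () renaming (_∈?_ to _∈ₗ?_)
open import Data.Fin.Subset using (Subset; ∣_∣; _∩_; ⊥)
open import Data.Fin.Subset.Properties using (_⊆?_; anySubset?)
open import Data.Product using (_×_; _,_)
open import Function using (_∘_)
open import Relation.Binary.PropositionalEquality using (_≡_)
open import Relation.Nullary using (Dec; ¬?)
open import Relation.Nullary.Decidable
  using (_×-dec_; _⊎-dec_; _→-dec_; map′; decidable-stable; toWitness)
open import Relation.Nullary.Negation using (¬∃⟶∀¬)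
open import Relation.Unary using (Pred; Decidable)

allSubset? : ∀ {n ℓ} {P : Pred (Subset n) ℓ} → Decidable P → Dec (∀ S → P S)
allSubset? P? = map′
  (λ noCounterexample S → decidable-stable (P? S) (¬∃⟶∀¬ noCounterexample S))
  (λ allP (S , ¬PS) → ¬PS (allP S))
  (¬? (anySubset? (¬? ∘ P?)))

infix 4 _≟ₛ_

_≟ₛ_ : ∀ {n} (S T : Subset n) → Dec (S ≡ T)
_≟ₛ_ = ≡-dec _≟ᵇ_

trace? : ∀ {n} {𝓖 : Family n} → Decidable 𝓖 → ∀ X → Decidable (Trace 𝓖 X)
trace? 𝓖? X S = anySubset? (λ G → 𝓖? G ×-dec (G ∩ X ≟ₛ S))

almostShatters? : ∀ {n} {𝓖 : Family n} → Decidable 𝓖 → Decidable (AlmostShatters 𝓖)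
almostShatters? 𝓖? X =
  allSubset? (λ S → traceIff (S ⊆? X ×-dec ¬? (S ≟ₛ ⊥)))
    ⊎-dec allSubset? (λ S → traceIff (S ⊆? X ×-dec ¬? (S ≟ₛ X)))
  where
  traceIff : ∀ {S Q} → Dec Q → Dec ((Trace _ X S → Q) × (Q → Trace _ X S))
  traceIff {S} Q? = (trace? 𝓖? X S →-dec Q?) ×-dec (Q? →-dec trace? 𝓖? X S)

𝓕? : Decidable 𝓕
𝓕? F = (∣ F ∣ ℕ.≟ 3) ×-dec (elemSum F % 6 ∈ₗ? (1 ∷ 3 ∷ 4 ∷ []))

claim1 : (A : Subset 6) → ∣ A ∣ ≡ 3 → AlmostShatters 𝓕 A
claim1 = toWitness {a? = allSubset? (λ A → (∣ A ∣ ℕ.≟ 3) →-dec almostShatters? 𝓕? A)} _
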